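{- Let $\alpha$ be any positive real and let $r\geq 2$ be any integer such that $r\alpha\geq 1$. Let $A(\alpha,r)$ be an algorithm solving fuel-constrained exploration for all instances of $\mathcal{I}(\alpha,r)$. Then for every positive integer $k$ there exists an instance $(G=(V,E),l_s,\alpha)$ of $\mathcal{I}(\alpha,r)$ such that $|V|\geq k$ and for which the penalty of $A$ is at least $\frac{|V|^2}{8\alpha}$.
   Context: Model. A mobile agent explores a finite, simple, undirected, connected graph $G=(V,E)$ starting from a source node $s$. Nodes have pairwise distinct integer labels; at each node $v$ the incident edges carry distinct local port numbers $0,\dots,\deg(v)-1$, with no relation between the two ports of an edge. Initially the agent knows only the label and degree of $s$. It runs a deterministic algorithm: at each step the algorithm, based on everything memorized so far, chooses a port at the current node and the agent traverses the corresponding edge; on arrival it learns the label and degree of the new node and the incoming port number. The agent has unbounded memory. Exploration requires traversing every edge (hence visiting every node) at least once. Fuel-constrained exploration: let $r$ be the eccentricity of $s$ in $G$ and $\alpha>0$ a real constant with $r\alpha\geq 1$. The agent has a fuel tank of size $B=2(1+\alpha)r$ that can be refilled only at $s$: it may make at most $\lfloor B\rfloor$ edge traversals between two consecutive visits to $s$ (starting from $s$). Both $\alpha$ and $r$ are given to the algorithm in advance. An instance is a tuple $(G,l_s,\alpha)$ where $l_s$ is the label of $s$; $\mathcal{I}(\alpha,r)$ denotes the set of all instances $(G,l_s,\alpha)$ in which the eccentricity of the node labeled $l_s$ is $r$. The penalty of an algorithm on an instance with graph $G=(V,E)$ is the number of edge traversals it performs in excess of $|E|$. -}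

module Defs where

open import Data.Nat using (ℕ; zero; suc; _≤_; _<_; _<?_; _∸_; _*_)
open import Data.Integer using (ℤ; +_)
open import Data.Rational using (ℚ; _/_; 0ℚ; 1ℚ)
import Data.Rational as Q
open import Data.Empty using (⊥)
open import Data.Fin using (Fin; toℕ; fromℕ<)
open import Data.List using (List; []; _∷_; length; filter; map; allFin)
open import Data.Nat.ListAction using (sum)
open import Data.Maybe using (Maybe; just; nothing; _>>=_)
open import Data.Product using (Σ; _×_; _,_; proj₁; proj₂)
open import Data.Sum using (_⊎_)
open import Relation.Nullary using (¬_; yes; no)
open import Relation.Binary.PropositionalEquality using (_≡_; _≢_)

-- Real numbers (agda-stdlib has none): two-sided Dedekind cuts on ℚ.
-- Lower x q  means  q < x ;  Upper x q  means  x < q.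

record ℝ : Set₁ where
  field
    Lower : ℚ → Set
    Upper : ℚ → Set
    lower-inhabited : Σ ℚ Lower
    upper-inhabited : Σ ℚ Upper
    lower-down  : ∀ p q → p Q.< q → Lower q → Lower p
    upper-up    : ∀ p q → p Q.< q → Upper p → Upper q
    lower-open  : ∀ q → Lower q → Σ ℚ λ p → q Q.< p × Lower p
    upper-open  : ∀ q → Upper q → Σ ℚ λ p → p Q.< q × Upper p
    disjoint    : ∀ q → Lower q → Upper q → ⊥
    located     : ∀ p q → p Q.< q → Lower p ⊎ Upper q
open ℝ public

ℕtoℚ : ℕ → ℚ
ℕtoℚ n = + n / 1

-- For a real x and a strictly increasing continuous rational expression f,
-- "c ≤ f(x)" holds iff c < f(u) for every rational u > x (u in the upper cut).

Positive : ℝ → Set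
Positive α = Lower α 0ℚ

-- r · α ≥ 1
RAlphaAtLeast1 : ℕ → ℝ → Set
RAlphaAtLeast1 r α = ∀ u → Upper α u → 1ℚ Q.< ℕtoℚ r Q.* u

-- F = ⌊ B ⌋ where B = 2 (1 + α) r, i.e.  F ≤ B  and  B < F + 1.
IsFloorFuel : ℝ → ℕ → ℕ → Set
IsFloorFuel α r F =
  (∀ u → Upper α u → ℕtoℚ F Q.< ℕtoℚ (2 * r) Q.* (1ℚ Q.+ u))
  × Σ ℚ (λ u → Upper α u × (ℕtoℚ (2 * r) Q.* (1ℚ Q.+ u)) Q.≤ ℕtoℚ (suc F))

-- p ≥ N / (8 α), i.e. 8 · α · p ≥ N   (α > 0)
PenaltyAtLeast : ℝ → (p N : ℕ) → Set
PenaltyAtLeast α p N = ∀ u → Upper α u → ℕtoℚ N Q.< ℕtoℚ (8 * p) Q.* u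

-- Finite simple undirected graphs with distinct integer node labels and
-- local port numbering 0 .. deg(v)-1 at each node (ports = Fin (deg v)).
-- adj v i = (w , j): the edge at port i of v leads to w, where it has port j.

record PortGraph : Set where
  field
    n      : ℕ
    label  : Fin n → ℤ
    label-injective : ∀ u v → label u ≡ label v → u ≡ v
    deg    : Fin n → ℕ
    adj    : (v : Fin n) → Fin (deg v) → Σ (Fin n) (λ w → Fin (deg w))
    adj-involutive : ∀ v i → adj (proj₁ (adj v i)) (proj₂ (adj v i)) ≡ (v , i)
    no-loop  : ∀ v i → proj₁ (adj v i) ≢ v
    no-multi : ∀ v i j → proj₁ (adj v i) ≡ proj₁ (adj v j) → i ≡ j
open PortGraph public

module _ (G : PortGraph) where

  data Walk : Fin (n G) → Fin (n G) → ℕ → Set where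
    here : ∀ {v} → Walk v v 0
    step : ∀ {u w ℓ} (i : Fin (deg G u)) → Walk (proj₁ (adj G u i)) w ℓ → Walk u w (suc ℓ)

  Eccentricity : Fin (n G) → ℕ → Set
  Eccentricity s r =
    (∀ v → Σ ℕ λ ℓ → ℓ ≤ r × Walk s v ℓ)
    × Σ (Fin (n G)) (λ v → ∀ ℓ → Walk s v ℓ → r ≤ ℓ)

  -- |E|: each edge {v,w} is counted once, at its endpoint of smaller index
  numEdges : ℕ
  numEdges = sum (map (λ v → length (filter (λ i → toℕ v <? toℕ (proj₁ (adj G v i)))
                                             (allFin (deg G v))))
                      (allFin (n G)))

-- Observation at a node: (label , degree).
-- A step record: (chosen port , label of new node , degree of new node , incoming port).
-- History: initial observation at s together with all steps (most recent first).

Obs : Set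
Obs = ℤ × ℕ

StepRecord : Set
StepRecord = ℕ × ℤ × ℕ × ℕ

History : Set
History = Obs × List StepRecord

-- The algorithm maps the whole memory to the next port to take, or stops.
Algorithm : Set
Algorithm = History → Maybe ℕ

module Execution (G : PortGraph) (s : Fin (n G)) (A : Algorithm) where

  Config : Set
  Config = Fin (n G) × History

  arrive : (v : Fin (n G)) → History → ℕ → Fin (deg G v) → Config
  arrive v h p i =
    proj₁ (adj G v i)
    , (proj₁ h , (p , label G (proj₁ (adj G v i)) , deg G (proj₁ (adj G v i))
                    , toℕ (proj₂ (adj G v i))) ∷ proj₂ h)

  -- one step: nothing if the algorithm stops or names a non-existent port
  stepC : Config → Maybe Config
  stepC (v , h) with A h
  ... | nothing = nothing
  ... | just p with p <? deg G v
  ...   | no _ = nothing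
  ...   | yes p<d = just (arrive v h p (fromℕ< p<d))

  conf : ℕ → Maybe Config
  conf zero = just (s , ((label G s , deg G s) , []))
  conf (suc t) = conf t >>= stepC

  At : ℕ → Fin (n G) → Set
  At m v = Σ History λ h → conf m ≡ just (v , h)

  Halts : ℕ → Set
  Halts T = Σ Config λ c → conf T ≡ just c × A (proj₂ c) ≡ nothing

  -- at most F traversals between consecutive visits to s (starting from s),
  -- including after the last visit
  FuelOK : ℕ → ℕ → Set
  FuelOK F T = ∀ i j → i ≤ j → j ≤ T → At i s
             → (∀ m → i < m → m < j → ¬ At m s) → j ∸ i ≤ F

  Covers : ℕ → Set
  Covers T = ∀ v (i : Fin (deg G v)) → Σ ℕ λ m → m < T ×
    ((At m v × At (suc m) (proj₁ (adj G v i)))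
     ⊎ (At m (proj₁ (adj G v i)) × At (suc m) v))

  Solves : ℕ → Set
  Solves F = Σ ℕ λ T → Halts T × FuelOK F T × Covers T

{-# OPTIONS --safe #-}
module Submission where

-- The lower-bound graph is a path from s to a hub at distance r - 1, the hub being joined to all
-- 2h vertices of a complete bipartite graph K_{h,h}.  All h² bipartite edges join vertices at
-- distance r, so the agent makes at least h² plateau moves, i.e. moves between two vertices at
-- level r, where the level L(t) is the distance from s of the agent at time t.  The level changes
-- by at most one per move, and between two visits to s the agent makes at most F moves; a trip
-- with d > 0 plateau moves therefore contains at least 2r other moves, so d ≤ F - 2r =: K and
-- 2r·d ≤ K·(other moves).  Summed over all trips (the last one possibly unfinished) this gives
-- 2r·D ≤ K·N + (2r + K)·r for the numbers D ≥ h² of plateau moves and N of other moves.  As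
-- F < 2(1 + u)r for every rational u > α, K < 2ru, so the penalty N + D - |E| is about
-- 2rh²/K > h²/u ≈ n²/(4u); taking h = 2r + 3K + k leaves room for all lower-order terms.

open import Defs
open import Data.Nat
open import Data.Nat.Properties
open import Data.Nat.ListAction using (sum)
open import Data.Nat.Tactic.RingSolver using (solve-∀)
open import Data.Nat.Coprimality using (1-coprimeTo)
import Data.Nat.Coprimality as Coprime
import Data.Integer as ℤ
import Data.Integer.Properties as ℤ
open import Data.Rational as ℚ using (ℚ; mkℚ; 0ℚ; 1ℚ)
import Data.Rational.Properties as ℚ
open import Data.Fin as Fin using (Fin; toℕ; fromℕ<; remQuot; combine)
open import Data.Fin.Properties using (toℕ-injective; toℕ-fromℕ<; toℕ<n; injective⇒≤; combine-remQuot)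
open import Data.List using (length; filter; allFin; tabulate; applyUpTo)
open import Data.List.Properties using (length-filter; filter-none; map-tabulate; length-tabulate)
open import Data.List.Relation.Unary.All.Properties using (tabulate⁺)
open import Data.Bool using (if_then_else_)
open import Data.Maybe using (just; nothing)
open import Data.Product using (Σ; _×_; _,_; proj₁; proj₂; uncurry)
open import Data.Sum using (_⊎_; inj₁; inj₂; map₂)
open import Data.Empty using (⊥-elim)
open import Function using (id; _∘_)
open import Relation.Binary.Definitions using (tri<; tri≈; tri>)
open import Relation.Binary.PropositionalEquality
open import Relation.Nullary using (¬_; Dec; yes; no; does; ¬?; _×-dec_)
open import Relation.Unary using (Decidable)

-- Rational estimates

ℕtoℚ-mkℚ : ∀ m → ℕtoℚ m ≡ mkℚ (ℤ.+ m) 0 (Coprime.sym (1-coprimeTo m))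
ℕtoℚ-mkℚ m = ℚ.normalize-coprime _

ℕtoℚ-homo-+ : ∀ a b → ℕtoℚ (a + b) ≡ ℕtoℚ a ℚ.+ ℕtoℚ b
ℕtoℚ-homo-+ a b rewrite ℕtoℚ-mkℚ a | ℕtoℚ-mkℚ b =
  cong (λ i → i ℚ./ 1) (sym (cong₂ ℤ._+_ (ℤ.*-identityʳ (ℤ.+ a)) (ℤ.*-identityʳ (ℤ.+ b))))

ℕtoℚ-homo-* : ∀ a b → ℕtoℚ (a * b) ≡ ℕtoℚ a ℚ.* ℕtoℚ b
ℕtoℚ-homo-* a b rewrite ℕtoℚ-mkℚ a | ℕtoℚ-mkℚ b = cong (λ i → i ℚ./ 1) (ℤ.pos-* a b)

ℕtoℚ-mono-≤ : ∀ {a b} → a ≤ b → ℕtoℚ a ℚ.≤ ℕtoℚ b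
ℕtoℚ-mono-≤ {a} {b} a≤b rewrite ℕtoℚ-mkℚ a | ℕtoℚ-mkℚ b =
  ℚ.*≤* (subst₂ ℤ._≤_ (sym (ℤ.*-identityʳ (ℤ.+ a))) (sym (ℤ.*-identityʳ (ℤ.+ b))) (ℤ.+≤+ a≤b))

ℕtoℚ-mono-< : ∀ {a b} → a < b → ℕtoℚ a ℚ.< ℕtoℚ b
ℕtoℚ-mono-< {a} {b} a<b rewrite ℕtoℚ-mkℚ a | ℕtoℚ-mkℚ b =
  ℚ.*<* (subst₂ ℤ._<_ (sym (ℤ.*-identityʳ (ℤ.+ a))) (sym (ℤ.*-identityʳ (ℤ.+ b))) (ℤ.+<+ a<b))

ℕtoℚ-positive : ∀ {a} → 0 < a → ℚ.Positive (ℕtoℚ a)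
ℕtoℚ-positive {a} 0<a = ℚ.positive (subst (ℚ._< ℕtoℚ a) (ℕtoℚ-mkℚ 0) (ℕtoℚ-mono-< 0<a))

Lower<Upper : (x : ℝ) → ∀ {p q} → Lower x p → Upper x q → p ℚ.< q
Lower<Upper x {p} {q} xp xq with ℚ.<-cmp p q
... | tri< p<q _ _ = p<q
... | tri≈ _ refl _ = ⊥-elim (disjoint x p xp xq)
... | tri> _ _ q<p = ⊥-elim (disjoint x p xp (upper-up x q p q<p xq))

m<n[1+u]⇒m∸n<nu : ∀ {m n u} → 0 < n → 0ℚ ℚ.< u → ℕtoℚ m ℚ.< ℕtoℚ n ℚ.* (1ℚ ℚ.+ u)
                 → ℕtoℚ (m ∸ n) ℚ.< ℕtoℚ n ℚ.* u
m<n[1+u]⇒m∸n<nu {m} {n} {u} 0<n 0<u m<n[1+u] with n ≤? m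
... | no n≰m = begin-strict
  ℕtoℚ (m ∸ n)      ≡⟨ cong ℕtoℚ (m≤n⇒m∸n≡0 (<⇒≤ (≰⇒> n≰m))) ⟩
  ℕtoℚ 0            ≡⟨ ℕtoℚ-mkℚ 0 ⟩
  0ℚ                ≡⟨ ℚ.*-zeroʳ (ℕtoℚ n) ⟨
  ℕtoℚ n ℚ.* 0ℚ     <⟨ ℚ.*-monoʳ-<-pos (ℕtoℚ n) {{ℕtoℚ-positive 0<n}} 0<u ⟩
  ℕtoℚ n ℚ.* u      ∎
  where open ℚ.≤-Reasoning
... | yes n≤m with ℕtoℚ (m ∸ n) ℚ.<? ℕtoℚ n ℚ.* u
...   | yes m∸n<nu = m∸n<nu
...   | no m∸n≮nu = ⊥-elim (ℚ.<-irrefl refl (ℚ.<-≤-trans m<n[1+u] (begin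
  ℕtoℚ n ℚ.* (1ℚ ℚ.+ u)               ≡⟨ ℚ.*-distribˡ-+ (ℕtoℚ n) 1ℚ u ⟩
  ℕtoℚ n ℚ.* 1ℚ ℚ.+ ℕtoℚ n ℚ.* u      ≡⟨ cong (ℚ._+ ℕtoℚ n ℚ.* u) (ℚ.*-identityʳ (ℕtoℚ n)) ⟩
  ℕtoℚ n ℚ.+ ℕtoℚ n ℚ.* u             ≡⟨ ℚ.+-comm (ℕtoℚ n) (ℕtoℚ n ℚ.* u) ⟩
  ℕtoℚ n ℚ.* u ℚ.+ ℕtoℚ n             ≤⟨ ℚ.+-monoˡ-≤ (ℕtoℚ n) (ℚ.≮⇒≥ m∸n≮nu) ⟩
  ℕtoℚ (m ∸ n) ℚ.+ ℕtoℚ n             ≡⟨ ℕtoℚ-homo-+ (m ∸ n) n ⟨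
  ℕtoℚ (m ∸ n + n)                    ≡⟨ cong ℕtoℚ (m∸n+n≡m n≤m) ⟩
  ℕtoℚ m                              ∎)))
  where open ℚ.≤-Reasoning

0<m∧0<n⇒0<m*n : ∀ {m n} → 0 < m → 0 < n → 0 < m * n
0<m∧0<n⇒0<m*n {suc _} {suc _} _ _ = z<s

0<m≤n*o⇒0<n : ∀ {m n o} → 0 < m → m ≤ n * o → 0 < n
0<m≤n*o⇒0<n {n = zero} 0<m m≤0 = ⊥-elim (<⇒≱ 0<m m≤0)
0<m≤n*o⇒0<n {n = suc _} _ _ = z<s

nx≤pk∧k<nu⇒x<pu : ∀ {n x p k u} → 0 < n → 0 < x → n * x ≤ p * k → ℕtoℚ k ℚ.< ℕtoℚ n ℚ.* u
                 → ℕtoℚ x ℚ.< ℕtoℚ p ℚ.* u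
nx≤pk∧k<nu⇒x<pu {n} {x} {p} {k} {u} 0<n 0<x nx≤pk k<nu =
  ℚ.*-cancelˡ-<-nonNeg (ℕtoℚ n) {{ℚ.pos⇒nonNeg (ℕtoℚ n) {{ℕtoℚ-positive 0<n}}}} (begin-strict
    ℕtoℚ n ℚ.* ℕtoℚ x           ≡⟨ ℕtoℚ-homo-* n x ⟨
    ℕtoℚ (n * x)                ≤⟨ ℕtoℚ-mono-≤ nx≤pk ⟩
    ℕtoℚ (p * k)                ≡⟨ ℕtoℚ-homo-* p k ⟩
    ℕtoℚ p ℚ.* ℕtoℚ k           <⟨ ℚ.*-monoʳ-<-pos (ℕtoℚ p) {{ℕtoℚ-positive 0<p}} k<nu ⟩
    ℕtoℚ p ℚ.* (ℕtoℚ n ℚ.* u)   ≡⟨ ℚ.*-assoc (ℕtoℚ p) (ℕtoℚ n) u ⟨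
    ℕtoℚ p ℚ.* ℕtoℚ n ℚ.* u     ≡⟨ cong (ℚ._* u) (ℚ.*-comm (ℕtoℚ p) (ℕtoℚ n)) ⟩
    ℕtoℚ n ℚ.* ℕtoℚ p ℚ.* u     ≡⟨ ℚ.*-assoc (ℕtoℚ n) (ℕtoℚ p) u ⟩
    ℕtoℚ n ℚ.* (ℕtoℚ p ℚ.* u)   ∎)
  where
  open ℚ.≤-Reasoning
  0<p : 0 < p
  0<p = 0<m≤n*o⇒0<n (0<m∧0<n⇒0<m*n 0<n 0<x) nx≤pk

-- Finite sums and counting

sum-tabulate-≤ : ∀ {m} (f : Fin m → ℕ) (b : ℕ → ℕ) → (∀ v → f v ≤ b (toℕ v))
               → sum (tabulate f) ≤ sum (applyUpTo b m)
sum-tabulate-≤ {zero} f b f≤b = z≤n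
sum-tabulate-≤ {suc m} f b f≤b = +-mono-≤ (f≤b Fin.zero) (sum-tabulate-≤ (f ∘ Fin.suc) (b ∘ suc) (f≤b ∘ Fin.suc))

sum-applyUpTo-+ : ∀ (b : ℕ → ℕ) m o → sum (applyUpTo b (m + o)) ≡ sum (applyUpTo b m) + sum (applyUpTo (b ∘ (m +_)) o)
sum-applyUpTo-+ b zero o = refl
sum-applyUpTo-+ b (suc m) o = trans (cong (b 0 +_) (sum-applyUpTo-+ (b ∘ suc) m o)) (sym (+-assoc (b 0) _ _))

sum-applyUpTo-≤ : ∀ (b : ℕ → ℕ) {c} m → (∀ i → i < m → b i ≤ c) → sum (applyUpTo b m) ≤ m * c
sum-applyUpTo-≤ b zero b≤c = z≤n
sum-applyUpTo-≤ b (suc m) b≤c = +-mono-≤ (b≤c 0 z<s) (sum-applyUpTo-≤ (b ∘ suc) m (λ i i<m → b≤c (suc i) (s<s i<m)))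

count : {P : ℕ → Set} → Decidable P → ℕ → ℕ
count P? zero = 0
count P? (suc t) = if does (P? t) then suc (count P? t) else count P? t

module _ {P : ℕ → Set} (P? : Decidable P) where

  count-yes : ∀ {t} → P t → count P? (suc t) ≡ suc (count P? t)
  count-yes {t} pt with P? t
  ... | yes _ = refl
  ... | no ¬pt = ⊥-elim (¬pt pt)

  count-no : ∀ {t} → ¬ P t → count P? (suc t) ≡ count P? t
  count-no {t} ¬pt with P? t
  ... | yes pt = ⊥-elim (¬pt pt)
  ... | no _ = refl

  count-≤-suc : ∀ t → count P? t ≤ count P? (suc t)
  count-≤-suc t with P? t
  ... | yes _ = n≤1+n _
  ... | no _ = ≤-refl

  count-mono : ∀ {t t′} → t ≤ t′ → count P? t ≤ count P? t′
  count-mono {t′ = zero} z≤n = ≤-refl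
  count-mono {t} {suc t′} t≤1+t′ with m≤n⇒m<n∨m≡n t≤1+t′
  ... | inj₁ t<1+t′ = ≤-trans (count-mono (s≤s⁻¹ t<1+t′)) (count-≤-suc t′)
  ... | inj₂ refl = ≤-refl

  count-strict : ∀ {t t′} → P t → t < t′ → count P? t < count P? t′
  count-strict pt t<t′ = ≤-trans (≤-reflexive (sym (count-yes pt))) (count-mono t<t′)

  count-complement : ∀ t → count P? t + count (¬? ∘ P?) t ≡ t
  count-complement zero = refl
  count-complement (suc t) with P? t
  ... | yes _ = cong suc (count-complement t)
  ... | no _ = trans (+-suc _ _) (cong suc (count-complement t))

  count-injective : ∀ {t t′} → P t → P t′ → count P? t ≡ count P? t′ → t ≡ t′
  count-injective {t} {t′} pt pt′ eq with <-cmp t t′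
  ... | tri< t<t′ _ _ = ⊥-elim (<-irrefl eq (count-strict pt t<t′))
  ... | tri≈ _ t≡t′ _ = t≡t′
  ... | tri> _ _ t′<t = ⊥-elim (<-irrefl (sym eq) (count-strict pt′ t′<t))

  injective-marked⇒≤count : ∀ {m T} (f : Fin m → ℕ) → (∀ {z z′} → f z ≡ f z′ → z ≡ z′)
                          → (∀ z → f z < T) → (∀ z → P (f z)) → m ≤ count P? T
  injective-marked⇒≤count f f-injective f<T marked = injective⇒≤ {f = rank} rank-injective
    where
    rank : Fin _ → Fin _
    rank z = fromℕ< (count-strict (marked z) (f<T z))
    rank-injective : ∀ {z z′} → rank z ≡ rank z′ → z ≡ z′
    rank-injective {z} {z′} eq = f-injective (count-injective (marked z) (marked z′)
      (trans (sym (toℕ-fromℕ< _)) (trans (cong toℕ eq) (toℕ-fromℕ< _))))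

-- Level sequences with bounded excursions

plateau-budget : ∀ r F {s d ℓ} → s + d ≤ F → d ≡ 0 ⊎ 2 * r ≤ s + ℓ
               → 2 * r * d ≤ (F ∸ 2 * r) * s + (2 * r + (F ∸ 2 * r)) * ℓ
plateau-budget r F _ (inj₁ refl) = ≤-trans (≤-reflexive (*-zeroʳ (2 * r))) z≤n
plateau-budget r F {s} {d} {ℓ} s+d≤F (inj₂ 2r≤s+ℓ) = +-cancelʳ-≤ (R * s) (R * d) _ (begin
  R * d + R * s                 ≡⟨ trans (+-comm (R * d) (R * s)) (sym (*-distribˡ-+ R s d)) ⟩
  R * (s + d)                   ≤⟨ *-monoʳ-≤ R s+d≤F ⟩
  R * F                         ≤⟨ *-monoʳ-≤ R (m≤n+m∸n F R) ⟩
  R * (R + K)                   ≡⟨ *-comm R (R + K) ⟩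
  (R + K) * R                   ≤⟨ *-monoʳ-≤ (R + K) 2r≤s+ℓ ⟩
  (R + K) * (s + ℓ)             ≡⟨ rearrange R K s ℓ ⟩
  K * s + (R + K) * ℓ + R * s   ∎)
  where
  open ≤-Reasoning
  R K : ℕ
  R = 2 * r
  K = F ∸ R
  rearrange : ∀ R K s ℓ → (R + K) * (s + ℓ) ≡ K * s + (R + K) * ℓ + R * s
  rearrange = solve-∀

module Excursions (L : ℕ → ℕ) (r F T : ℕ)
  (L-origin : L 0 ≡ 0)
  (L-step : ∀ t → t < T → L (suc t) ≤ suc (L t) × L t ≤ suc (L (suc t)))
  (fuel : ∀ i j → i ≤ j → j ≤ T → L i ≡ 0 → (∀ m → i < m → m < j → L m ≢ 0) → j ∸ i ≤ F)
  where

  K : ℕ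
  K = F ∸ 2 * r

  plateau? : ∀ t → Dec (L t ≡ r × L (suc t) ≡ r)
  plateau? t = (L t ≟ r) ×-dec (L (suc t) ≟ r)

  plateaus slopes : ℕ → ℕ
  plateaus = count plateau?
  slopes = count (¬? ∘ plateau?)

  -- The steps in [i, t) of a trip starting at level 0: once a plateau step has occurred the walk
  -- has climbed to level r and still has to come down, which is what top-reached records.
  record Excursion (i t : ℕ) : Set where
    field
      sloped flat : ℕ
      slopes-split : slopes t ≡ slopes i + sloped
      plateaus-split : plateaus t ≡ plateaus i + flat
      depth≤sloped : L t ≤ sloped
      top-reached : flat ≡ 0 ⊎ 2 * r ≤ sloped + L t

  excursion-empty : ∀ {i} → L i ≡ 0 → Excursion i i
  excursion-empty Li≡0 = record
    { sloped = 0 ; flat = 0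
    ; slopes-split = sym (+-identityʳ _) ; plateaus-split = sym (+-identityʳ _)
    ; depth≤sloped = ≤-reflexive Li≡0 ; top-reached = inj₁ refl }

  excursion-step : ∀ {i t} → t < T → Excursion i t → Excursion i (suc t)
  excursion-step {i} {t} t<T E with plateau? t
  ... | yes (Lt≡r , Lt+1≡r) = record
    { sloped = sloped ; flat = suc flat
    ; slopes-split = trans (count-no (¬? ∘ plateau?) (λ ¬plateau → ¬plateau (Lt≡r , Lt+1≡r))) slopes-split
    ; plateaus-split = trans (count-yes plateau? (Lt≡r , Lt+1≡r)) (trans (cong suc plateaus-split) (sym (+-suc _ _)))
    ; depth≤sloped = subst (_≤ sloped) (trans Lt≡r (sym Lt+1≡r)) depth≤sloped
    ; top-reached = inj₂ (begin
        2 * r                ≡⟨ cong (r +_) (+-identityʳ r) ⟩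
        r + r                ≤⟨ +-monoˡ-≤ r (subst (_≤ sloped) Lt≡r depth≤sloped) ⟩
        sloped + r           ≡⟨ cong (sloped +_) Lt+1≡r ⟨
        sloped + L (suc t)   ∎) }
    where
    open Excursion E
    open ≤-Reasoning
  ... | no ¬plateau = record
    { sloped = suc sloped ; flat = flat
    ; slopes-split = trans (count-yes (¬? ∘ plateau?) ¬plateau) (trans (cong suc slopes-split) (sym (+-suc _ _)))
    ; plateaus-split = trans (count-no plateau? ¬plateau) plateaus-split
    ; depth≤sloped = ≤-trans (proj₁ (L-step t t<T)) (s≤s depth≤sloped)
    ; top-reached = map₂ descend top-reached }
    where
    open Excursion E
    descend : 2 * r ≤ sloped + L t → 2 * r ≤ suc sloped + L (suc t)
    descend 2r≤ = ≤-trans 2r≤ (≤-trans (+-monoʳ-≤ sloped (proj₂ (L-step t t<T))) (≤-reflexive (+-suc sloped _)))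

  excursion-length : ∀ {i t} (E : Excursion i t) → Excursion.sloped E + Excursion.flat E ≡ t ∸ i
  excursion-length {i} {t} E = begin
    sloped + flat                                   ≡⟨ m+n∸m≡n i (sloped + flat) ⟨
    i + (sloped + flat) ∸ i                         ≡⟨ cong (λ x → x + (sloped + flat) ∸ i) (count-complement plateau? i) ⟨
    plateaus i + slopes i + (sloped + flat) ∸ i     ≡⟨ cong (_∸ i) (shuffle (plateaus i) (slopes i) sloped flat) ⟩
    (plateaus i + flat) + (slopes i + sloped) ∸ i   ≡⟨ cong₂ (λ a b → a + b ∸ i) plateaus-split slopes-split ⟨
    plateaus t + slopes t ∸ i                       ≡⟨ cong (_∸ i) (count-complement plateau? t) ⟩
    t ∸ i                                           ∎
    where
    open Excursion E
    open ≡-Reasoning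
    shuffle : ∀ a b c d → a + b + (c + d) ≡ (a + d) + (b + c)
    shuffle = solve-∀

  record Progress (t : ℕ) : Set where
    field
      visit : ℕ
      visit≤t : visit ≤ t
      at-origin : L visit ≡ 0
      away : ∀ m → visit < m → m < t → L m ≢ 0
      before : 2 * r * plateaus visit ≤ K * slopes visit
      current : Excursion visit t

  progress-bound : ∀ {t} → t ≤ T → Progress t → 2 * r * plateaus t ≤ K * slopes t + (2 * r + K) * L t
  progress-bound {t} t≤T P = begin
    2 * r * plateaus t                                    ≡⟨ cong (2 * r *_) plateaus-split ⟩
    2 * r * (plateaus visit + flat)                       ≡⟨ *-distribˡ-+ (2 * r) (plateaus visit) flat ⟩
    2 * r * plateaus visit + 2 * r * flat                 ≤⟨ +-mono-≤ before (plateau-budget r F trip≤F top-reached) ⟩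
    K * slopes visit + (K * sloped + (2 * r + K) * L t)   ≡⟨ +-assoc (K * slopes visit) (K * sloped) _ ⟨
    K * slopes visit + K * sloped + (2 * r + K) * L t     ≡⟨ cong (_+ (2 * r + K) * L t) (*-distribˡ-+ K (slopes visit) sloped) ⟨
    K * (slopes visit + sloped) + (2 * r + K) * L t       ≡⟨ cong (λ c → K * c + (2 * r + K) * L t) slopes-split ⟨
    K * slopes t + (2 * r + K) * L t                      ∎
    where
    open Progress P
    open Excursion current
    open ≤-Reasoning
    trip≤F : sloped + flat ≤ F
    trip≤F = subst (_≤ F) (sym (excursion-length current)) (fuel visit t visit≤t t≤T at-origin away)

  -- At a visit to the origin the current trip is closed, its bound moving into before.
  progress-step : ∀ {t} → t < T → Progress t → Progress (suc t)
  progress-step {t} t<T P with L t ≟ 0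
  ... | yes Lt≡0 = record
    { visit = t ; visit≤t = n≤1+n t ; at-origin = Lt≡0
    ; away = λ m t<m m<1+t → ⊥-elim (<⇒≱ t<m (s≤s⁻¹ m<1+t))
    ; before = subst (2 * r * plateaus t ≤_) back-home (progress-bound (<⇒≤ t<T) P)
    ; current = excursion-step t<T (excursion-empty Lt≡0) }
    where
    back-home : K * slopes t + (2 * r + K) * L t ≡ K * slopes t
    back-home = trans (cong (λ ℓ → K * slopes t + (2 * r + K) * ℓ) Lt≡0)
                      (trans (cong (K * slopes t +_) (*-zeroʳ (2 * r + K))) (+-identityʳ _))
  ... | no Lt≢0 = record
    { visit = visit ; visit≤t = m≤n⇒m≤1+n visit≤t ; at-origin = at-origin
    ; away = away′ ; before = before ; current = excursion-step t<T current }
    where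
    open Progress P
    away′ : ∀ m → visit < m → m < suc t → L m ≢ 0
    away′ m visit<m m<1+t with m≤n⇒m<n∨m≡n (s≤s⁻¹ m<1+t)
    ... | inj₁ m<t = away m visit<m m<t
    ... | inj₂ refl = Lt≢0

  progress : ∀ t → t ≤ T → Progress t
  progress zero _ = record
    { visit = 0 ; visit≤t = z≤n ; at-origin = L-origin
    ; away = λ m 0<m m<0 → ⊥-elim (<⇒≱ m<0 z≤n)
    ; before = ≤-reflexive (trans (*-zeroʳ (2 * r)) (sym (*-zeroʳ K)))
    ; current = excursion-empty L-origin }
  progress (suc t) t<T = progress-step t<T (progress t (<⇒≤ t<T))

  plateaus-bound : 2 * r * plateaus T ≤ K * slopes T + (2 * r + K) * L T
  plateaus-bound = progress-bound ≤-refl (progress T ≤-refl)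

-- Port graphs and executions

module _ (G : PortGraph) where

  walk-snoc : ∀ {u v ℓ} → Walk G u v ℓ → (i : Fin (deg G v)) → Walk G u (proj₁ (adj G v i)) (suc ℓ)
  walk-snoc here i = step i here
  walk-snoc (step j w) i = step j (walk-snoc w i)

  module _ (lvl : Fin (n G) → ℕ) (lvl-step : ∀ v i → lvl (proj₁ (adj G v i)) ≤ suc (lvl v)) where

    walk-level : ∀ {u v ℓ} → Walk G u v ℓ → lvl v ≤ lvl u + ℓ
    walk-level here = m≤m+n _ 0
    walk-level {u} {ℓ = suc ℓ} (step i w) =
      ≤-trans (walk-level w) (≤-trans (+-monoˡ-≤ ℓ (lvl-step u i)) (≤-reflexive (sym (+-suc (lvl u) ℓ))))

    lvl-step-back : ∀ v i → lvl v ≤ suc (lvl (proj₁ (adj G v i)))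
    lvl-step-back v i = subst (λ w → lvl w ≤ suc (lvl (proj₁ (adj G v i)))) (cong proj₁ (adj-involutive G v i))
                              (lvl-step (proj₁ (adj G v i)) (proj₂ (adj G v i)))

  upward-ports : Fin (n G) → ℕ
  upward-ports v = length (filter (λ i → toℕ v <? toℕ (proj₁ (adj G v i))) (allFin (deg G v)))

  upward-ports≤deg : ∀ v → upward-ports v ≤ deg G v
  upward-ports≤deg v = ≤-trans (length-filter (λ i → toℕ v <? toℕ (proj₁ (adj G v i))) (allFin (deg G v)))
                               (≤-reflexive (length-tabulate id))

  upward-ports-none : ∀ v → (∀ i → ¬ toℕ v < toℕ (proj₁ (adj G v i))) → upward-ports v ≡ 0
  upward-ports-none v none = cong length (filter-none (λ i → toℕ v <? toℕ (proj₁ (adj G v i))) (tabulate⁺ none))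

  numEdges-≤ : (b : ℕ → ℕ) → (∀ v → upward-ports v ≤ b (toℕ v)) → numEdges G ≤ sum (applyUpTo b (n G))
  numEdges-≤ b up≤b = subst (_≤ sum (applyUpTo b (n G))) (cong sum (sym (map-tabulate id upward-ports)))
                            (sum-tabulate-≤ upward-ports b up≤b)

module Trace (G : PortGraph) (s : Fin (n G)) (A : Algorithm) where
  open Execution G s A

  -- Once the run has stopped, position stays at the junk value s.
  position : ℕ → Fin (n G)
  position t with conf t
  ... | just (v , _) = v
  ... | nothing = s

  At⇒position : ∀ t {v} → At t v → position t ≡ v
  At⇒position t (_ , conf≡) with conf t
  At⇒position t (_ , refl) | just _ = refl

  Crosses : ℕ → Fin (n G) → Fin (n G) → Set
  Crosses m v w = (position m ≡ v × position (suc m) ≡ w) ⊎ (position m ≡ w × position (suc m) ≡ v)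

  covered-crossing : ∀ {T} → Covers T → ∀ v i → Σ ℕ λ m → m < T × Crosses m v (proj₁ (adj G v i))
  covered-crossing covers v i with covers v i
  ... | m , m<T , inj₁ (at-v , at-w) = m , m<T , inj₁ (At⇒position m at-v , At⇒position (suc m) at-w)
  ... | m , m<T , inj₂ (at-w , at-v) = m , m<T , inj₂ (At⇒position m at-w , At⇒position (suc m) at-v)

  crosses-same-edge : ∀ m {v w v′ w′} → Crosses m v w → Crosses m v′ w′
                    → (v ≡ v′ × w ≡ w′) ⊎ (v ≡ w′ × w ≡ v′)
  crosses-same-edge m (inj₁ (a , b)) (inj₁ (a′ , b′)) = inj₁ (trans (sym a) a′ , trans (sym b) b′)
  crosses-same-edge m (inj₁ (a , b)) (inj₂ (a′ , b′)) = inj₂ (trans (sym a) a′ , trans (sym b) b′)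
  crosses-same-edge m (inj₂ (a , b)) (inj₁ (a′ , b′)) = inj₂ (trans (sym b) b′ , trans (sym a) a′)
  crosses-same-edge m (inj₂ (a , b)) (inj₂ (a′ , b′)) = inj₁ (trans (sym b) b′ , trans (sym a) a′)

  crosses-level : ∀ (lvl : Fin (n G) → ℕ) m {v w c} → Crosses m v w → lvl v ≡ c → lvl w ≡ c
                → lvl (position m) ≡ c × lvl (position (suc m)) ≡ c
  crosses-level lvl m (inj₁ (refl , refl)) v≡c w≡c = v≡c , w≡c
  crosses-level lvl m (inj₂ (refl , refl)) v≡c w≡c = w≡c , v≡c

  conf-pred : ∀ t {c} → conf (suc t) ≡ just c → Σ Config λ c′ → conf t ≡ just c′ × stepC c′ ≡ just c
  conf-pred t conf≡ with conf t
  ... | just c′ = c′ , refl , conf≡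

  stepC-adj : ∀ {v h c} → stepC (v , h) ≡ just c → Σ (Fin (deg G v)) λ i → proj₁ c ≡ proj₁ (adj G v i)
  stepC-adj {v} {h} step≡ with A h
  ... | just p with p <? deg G v
  stepC-adj refl | just p | yes p<deg = fromℕ< p<deg , refl

  running-earlier : ∀ d t {c} → conf (d + t) ≡ just c → Σ Config λ c′ → conf t ≡ just c′
  running-earlier zero t conf≡ = _ , conf≡
  running-earlier (suc d) t conf≡ = running-earlier d t (proj₁ (proj₂ (conf-pred (d + t) conf≡)))

  module _ {T} (halts : Halts T) where

    running : ∀ {t} → t ≤ T → Σ Config λ c → conf t ≡ just c
    running {t} t≤T = running-earlier (T ∸ t) t (trans (cong conf (m∸n+n≡m t≤T)) (proj₁ (proj₂ halts)))

    At-position : ∀ {t} → t ≤ T → At t (position t)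
    At-position {t} t≤T with running t≤T
    ... | (v , h) , conf≡ = h , trans conf≡ (cong (λ w → just (w , h)) (sym (At⇒position t (h , conf≡))))

    position-step : ∀ {t} → t < T → Σ (Fin (deg G (position t))) λ i → position (suc t) ≡ proj₁ (adj G (position t) i)
    position-step {t} t<T with running t<T
    ... | c , conf≡ with conf-pred t conf≡
    ... | (v , h) , conf-t≡ , step≡ with stepC-adj step≡
    ... | i , c≡ = subst (λ w → Σ (Fin (deg G w)) λ i → position (suc t) ≡ proj₁ (adj G w i))
                         (sym (At⇒position t (h , conf-t≡))) (i , trans (At⇒position (suc t) (proj₂ c , conf≡)) c≡)

-- A port graph on the vertices 0, …, size - 1 given by tables: nbr v i is the neighbour behind
-- port i of v, and port v w is the port of v leading to w.
record Port (size : ℕ) (degree : ℕ → ℕ) (nbr port : ℕ → ℕ → ℕ) (v i : ℕ) : Set where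
  field
    nbr<size : nbr v i < size
    port<deg : port (nbr v i) v < degree (nbr v i)
    nbr-port : nbr (nbr v i) (port (nbr v i) v) ≡ v
    port-nbr : port v (nbr v i) ≡ i
    nbr≢     : nbr v i ≢ v

record PortTable : Set where
  field
    size   : ℕ
    degree : ℕ → ℕ
    nbr    : ℕ → ℕ → ℕ
    port   : ℕ → ℕ → ℕ
    valid  : ∀ {v i} → v < size → i < degree v → Port size degree nbr port v i

module TableGraph (τ : PortTable) where
  open PortTable τ

  private
    module V {v : Fin size} {i : Fin (degree (toℕ v))} = Port (valid (toℕ<n v) (toℕ<n i))

  adjacent : (v : Fin size) → Fin (degree (toℕ v)) → Σ (Fin size) λ w → Fin (degree (toℕ w))
  adjacent v i = fromℕ< (V.nbr<size {v} {i})
               , fromℕ< (subst (λ x → port x (toℕ v) < degree x) (sym (toℕ-fromℕ< _)) (V.port<deg {v} {i}))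

  adjacent-nbr : ∀ v i → toℕ (proj₁ (adjacent v i)) ≡ nbr (toℕ v) (toℕ i)
  adjacent-nbr v i = toℕ-fromℕ< _

  adjacent-port : ∀ v i → toℕ (proj₂ (adjacent v i)) ≡ port (toℕ (proj₁ (adjacent v i))) (toℕ v)
  adjacent-port v i = toℕ-fromℕ< _

  ports-≡ : ∀ {v w} {i : Fin (degree (toℕ v))} {j : Fin (degree (toℕ w))} → toℕ v ≡ toℕ w → toℕ i ≡ toℕ j
          → _≡_ {A = Σ (Fin size) λ u → Fin (degree (toℕ u))} (v , i) (w , j)
  ports-≡ v≡w i≡j with toℕ-injective v≡w
  ... | refl = cong (_ ,_) (toℕ-injective i≡j)

  adjacent-involutive : ∀ v i → adjacent (proj₁ (adjacent v i)) (proj₂ (adjacent v i)) ≡ (v , i)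
  adjacent-involutive v i = ports-≡ back-vertex back-port
    where
    w = proj₁ (adjacent v i)
    j = proj₂ (adjacent v i)
    j≡ : toℕ j ≡ port (nbr (toℕ v) (toℕ i)) (toℕ v)
    j≡ = trans (adjacent-port v i) (cong (λ x → port x (toℕ v)) (adjacent-nbr v i))
    back-vertex : toℕ (proj₁ (adjacent w j)) ≡ toℕ v
    back-vertex = trans (adjacent-nbr w j) (trans (cong₂ nbr (adjacent-nbr v i) j≡) (V.nbr-port {v} {i}))
    back-port : toℕ (proj₂ (adjacent w j)) ≡ toℕ i
    back-port = trans (adjacent-port w j) (trans (cong₂ port back-vertex (adjacent-nbr v i)) (V.port-nbr {v} {i}))

  graph : PortGraph
  graph = record
    { n = size
    ; label = λ v → ℤ.+ toℕ v
    ; label-injective = λ u v eq → toℕ-injective (ℤ.+-injective eq)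
    ; deg = degree ∘ toℕ
    ; adj = adjacent
    ; adj-involutive = adjacent-involutive
    ; no-loop = λ v i eq → V.nbr≢ {v} {i} (trans (sym (adjacent-nbr v i)) (cong toℕ eq))
    ; no-multi = λ v i j eq → toℕ-injective (trans (sym (V.port-nbr {v} {i}))
        (trans (cong (port (toℕ v)) (trans (sym (adjacent-nbr v i)) (trans (cong toℕ eq) (adjacent-nbr v j))))
               (V.port-nbr {v} {j})))
    }

  Reach : Fin size → ℕ → ℕ → Set
  Reach u ℓ v = Σ (Fin size) λ w → toℕ w ≡ v × Walk graph u w ℓ

  reach-step : ∀ {u ℓ v i} → Reach u ℓ v → i < degree v → Reach u (suc ℓ) (nbr v i)
  reach-step (w , refl , walk) i<deg =
    proj₁ (adjacent w p) , trans (adjacent-nbr w p) (cong (nbr (toℕ w)) (toℕ-fromℕ< i<deg)) , walk-snoc graph walk p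
    where
    p = fromℕ< i<deg

  reach-vertex : ∀ {u ℓ v} → Reach u ℓ (toℕ v) → Walk graph u v ℓ
  reach-vertex (w , w≡v , walk) = subst (λ x → Walk graph _ x _) (toℕ-injective w≡v) walk

  adjacent-level-step : (lvl : ℕ → ℕ) → (∀ {v i} → v < size → i < degree v → lvl (nbr v i) ≤ suc (lvl v))
                 → ∀ v i → lvl (toℕ (proj₁ (adjacent v i))) ≤ suc (lvl (toℕ v))
  adjacent-level-step lvl lvl-step v i = subst (λ x → lvl x ≤ _) (sym (adjacent-nbr v i)) (lvl-step (toℕ<n v) (toℕ<n i))

-- Vertices k ≤ q form the path, k being at distance k from s = 0, the hub is suc q, and the two
-- sides of K_{h,h} are r + x and r + h + y for x, y < h, where r = q + 2.  On the path port 0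
-- leads forward and port 1 back; at the hub and on K_{h,h} port 0 leads back towards s.
module BicliqueLollipop (q h : ℕ) (0<h : 0 < h) where

  r size : ℕ
  r = suc (suc q)
  size = r + (h + h)

  data Kind : Set where
    path : ℕ → Kind
    hub : Kind
    left right : ℕ → Kind

  kind : ℕ → Kind
  kind v with v ≤? q
  ... | yes _ = path v
  ... | no _ with v ≟ suc q
  ...   | yes _ = hub
  ...   | no _ with v <? r + h
  ...     | yes _ = left (v ∸ r)
  ...     | no _ = right (v ∸ (r + h))

  hub<r+ : ∀ m → suc q < r + m
  hub<r+ m = s≤s (s≤s (m≤m+n q m))

  q≤r : q ≤ r
  q≤r = ≤-trans (n≤1+n q) (n≤1+n (suc q))

  kind-path : ∀ {k} → k ≤ q → kind k ≡ path k
  kind-path {k} k≤q with k ≤? q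
  ... | yes _ = refl
  ... | no k≰q = ⊥-elim (k≰q k≤q)

  kind-hub : kind (suc q) ≡ hub
  kind-hub with suc q ≤? q
  ... | yes 1+q≤q = ⊥-elim (1+n≰n 1+q≤q)
  ... | no _ with suc q ≟ suc q
  ...   | yes _ = refl
  ...   | no 1+q≢1+q = ⊥-elim (1+q≢1+q refl)

  kind-left : ∀ {x} → x < h → kind (r + x) ≡ left x
  kind-left {x} x<h with r + x ≤? q
  ... | yes r+x≤q = ⊥-elim (<⇒≱ (<-trans (n<1+n q) (hub<r+ x)) r+x≤q)
  ... | no _ with r + x ≟ suc q
  ...   | yes r+x≡1+q = ⊥-elim (<⇒≢ (hub<r+ x) (sym r+x≡1+q))
  ...   | no _ with r + x <? r + h
  ...     | yes _ = cong left (m+n∸m≡n r x)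
  ...     | no r+x≮r+h = ⊥-elim (r+x≮r+h (+-monoʳ-< r x<h))

  kind-right : ∀ {y} → kind (r + h + y) ≡ right y
  kind-right {y} with r + h + y ≤? q
  ... | yes ≤q = ⊥-elim (<⇒≱ (<-trans (n<1+n q) (hub<r+ (h + y))) (subst (_≤ q) (+-assoc r h y) ≤q))
  ... | no _ with r + h + y ≟ suc q
  ...   | yes ≡1+q = ⊥-elim (<⇒≢ (hub<r+ (h + y)) (trans (sym ≡1+q) (+-assoc r h y)))
  ...   | no _ with r + h + y <? r + h
  ...     | yes <r+h = ⊥-elim (m+n≮m (r + h) y <r+h)
  ...     | no _ = cong right (m+n∸m≡n (r + h) y)

  data Shape : ℕ → Set where
    path-vertex  : ∀ k → k ≤ q → Shape k
    hub-vertex   : Shape (suc q)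
    left-vertex  : ∀ x → x < h → Shape (r + x)
    right-vertex : ∀ y → y < h → Shape (r + h + y)

  shape : ∀ {v} → v < size → Shape v
  shape {v} v<size with v ≤? q
  ... | yes v≤q = path-vertex v v≤q
  ... | no v≰q with v ≟ suc q
  ...   | yes refl = hub-vertex
  ...   | no v≢1+q with v <? r + h
  ...     | yes v<r+h = subst Shape (m+[n∸m]≡n r≤v)
                          (left-vertex (v ∸ r) (+-cancelˡ-< r _ _ (subst (_< r + h) (sym (m+[n∸m]≡n r≤v)) v<r+h)))
    where
    r≤v : r ≤ v
    r≤v = ≤∧≢⇒< (≰⇒> v≰q) (v≢1+q ∘ sym)
  ...     | no v≮r+h = subst Shape (m+[n∸m]≡n (≮⇒≥ v≮r+h))
                          (right-vertex (v ∸ (r + h)) (+-cancelˡ-< (r + h) _ _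
                            (subst₂ _<_ (sym (m+[n∸m]≡n (≮⇒≥ v≮r+h))) (sym (+-assoc r h h)) v<size)))

  pathPort : ℕ → ℕ → ℕ
  pathPort zero _ = 0
  pathPort (suc a) zero = 1
  pathPort (suc a) (suc b) = pathPort a b

  pathPort-next : ∀ k → pathPort k (suc k) ≡ 0
  pathPort-next zero = refl
  pathPort-next (suc k) = pathPort-next k

  pathPort-prev : ∀ k → pathPort (suc k) k ≡ 1
  pathPort-prev zero = refl
  pathPort-prev (suc k) = pathPort-prev k

  degK : Kind → ℕ
  degK (path zero) = 1
  degK (path (suc _)) = 2
  degK hub = suc (h + h)
  degK (left _) = suc h
  degK (right _) = suc h

  nbrK : Kind → ℕ → ℕ
  nbrK (path k) zero = suc k
  nbrK (path k) (suc _) = pred k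
  nbrK hub zero = q
  nbrK hub (suc j) = r + j
  nbrK (left _) zero = suc q
  nbrK (left _) (suc y) = r + h + y
  nbrK (right _) zero = suc q
  nbrK (right _) (suc x) = r + x

  portK : Kind → Kind → ℕ
  portK (path a) (path b) = pathPort a b
  portK hub (left x) = suc x
  portK hub (right y) = suc (h + y)
  portK (left _) (right y) = suc y
  portK (right _) (left x) = suc x
  portK _ _ = 0

  levelK : Kind → ℕ
  levelK (path k) = k
  levelK hub = suc q
  levelK (left _) = r
  levelK (right _) = r

  degK-pos : ∀ k → 0 < degK (path k)
  degK-pos zero = z<s
  degK-pos (suc _) = z<s

  -- Port i of v, a vertex of kind k, leads to a vertex of kind k′.  Stated on kinds so that every
  -- case below computes; Edge v i is the instance with the actual kinds.
  record Link (k : Kind) (v i : ℕ) (k′ : Kind) : Set where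
    field
      nbr<size : nbrK k i < size
      back<deg : portK k′ k < degK k′
      back-nbr : nbrK k′ (portK k′ k) ≡ v
      port-nbr : portK k k′ ≡ i
      nbr≢     : nbrK k i ≢ v
      level    : levelK k′ ≤ suc (levelK k)

  Edge : ℕ → ℕ → Set
  Edge v i = Link (kind v) v i (kind (nbrK (kind v) i))

  link : ∀ {v i k k′} → kind v ≡ k → kind (nbrK k i) ≡ k′ → Link k v i k′ → Edge v i
  link refl refl l = l

  path<size : ∀ {k} → k ≤ suc q → k < size
  path<size k≤1+q = ≤-trans (s≤s k≤1+q) (m≤m+n r (h + h))

  left<size : ∀ {x} → x < h → r + x < size
  left<size x<h = +-monoʳ-< r (≤-trans x<h (m≤m+n h h))

  right<size : ∀ {y} → y < h → r + h + y < size
  right<size y<h = subst (_< size) (sym (+-assoc r h _)) (+-monoʳ-< r (+-monoʳ-< h y<h))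

  left<right : ∀ {x} y → x < h → r + x < r + h + y
  left<right {x} y x<h = subst (r + x <_) (sym (+-assoc r h y)) (+-monoʳ-< r (≤-trans x<h (m≤m+n h y)))

  edge-path : ∀ {k i} → k ≤ q → i < degK (path k) → Edge k i
  edge-path {k} {zero} k≤q _ with m≤n⇒m<n∨m≡n k≤q
  ... | inj₁ k<q = link (kind-path k≤q) (kind-path k<q) record
    { nbr<size = path<size (s≤s k≤q) ; back<deg = subst (_< 2) (sym (pathPort-prev k)) (s≤s z<s)
    ; back-nbr = cong (nbrK (path (suc k))) (pathPort-prev k) ; port-nbr = pathPort-next k
    ; nbr≢ = 1+n≢n ; level = ≤-refl }
  ... | inj₂ refl = link (kind-path k≤q) kind-hub record
    { nbr<size = path<size ≤-refl ; back<deg = z<s ; back-nbr = refl ; port-nbr = refl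
    ; nbr≢ = 1+n≢n ; level = ≤-refl }
  edge-path {suc k} {suc zero} k≤q _ = link (kind-path k≤q) (kind-path (<⇒≤ k≤q)) record
    { nbr<size = path<size (≤-trans (n≤1+n k) (s≤s (<⇒≤ k≤q)))
    ; back<deg = subst (_< degK (path k)) (sym (pathPort-next k)) (degK-pos k)
    ; back-nbr = cong (nbrK (path k)) (pathPort-next k) ; port-nbr = pathPort-prev k
    ; nbr≢ = 1+n≢n ∘ sym ; level = ≤-trans (n≤1+n k) (n≤1+n (suc k)) }
  edge-path {zero} {suc _} _ (s≤s ())
  edge-path {suc _} {suc (suc _)} _ (s≤s (s≤s ()))

  edge-hub : ∀ {i} → i < degK hub → Edge (suc q) i
  edge-hub {zero} _ = link kind-hub (kind-path ≤-refl) record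
    { nbr<size = path<size (n≤1+n q) ; back<deg = degK-pos q ; back-nbr = refl ; port-nbr = refl
    ; nbr≢ = 1+n≢n ∘ sym ; level = q≤r }
  edge-hub {suc j} (s≤s j<h+h) with j <? h
  ... | yes j<h = link kind-hub (kind-left j<h) record
    { nbr<size = left<size j<h ; back<deg = z<s ; back-nbr = refl ; port-nbr = refl
    ; nbr≢ = <⇒≢ (hub<r+ j) ∘ sym ; level = ≤-refl }
  ... | no j≮h = link kind-hub (trans (cong kind r+j≡) kind-right) record
    { nbr<size = +-monoʳ-< r j<h+h ; back<deg = z<s ; back-nbr = refl
    ; port-nbr = cong suc (m+[n∸m]≡n (≮⇒≥ j≮h)) ; nbr≢ = <⇒≢ (hub<r+ j) ∘ sym ; level = ≤-refl }
    where
    r+j≡ : r + j ≡ r + h + (j ∸ h)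
    r+j≡ = trans (cong (r +_) (sym (m+[n∸m]≡n (≮⇒≥ j≮h)))) (sym (+-assoc r h _))

  edge-left : ∀ {x i} → x < h → i < degK (left x) → Edge (r + x) i
  edge-left {x} {zero} x<h _ = link (kind-left x<h) kind-hub record
    { nbr<size = path<size ≤-refl ; back<deg = s≤s (≤-trans x<h (m≤m+n h h)) ; back-nbr = refl ; port-nbr = refl
    ; nbr≢ = <⇒≢ (hub<r+ x) ; level = ≤-trans (n≤1+n (suc q)) (n≤1+n r) }
  edge-left {x} {suc y} x<h (s≤s y<h) = link (kind-left x<h) kind-right record
    { nbr<size = right<size y<h ; back<deg = s≤s x<h ; back-nbr = refl ; port-nbr = refl
    ; nbr≢ = <⇒≢ (left<right y x<h) ∘ sym ; level = n≤1+n r }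

  edge-right : ∀ {y i} → y < h → i < degK (right y) → Edge (r + h + y) i
  edge-right {y} {zero} y<h _ = link kind-right kind-hub record
    { nbr<size = path<size ≤-refl ; back<deg = s≤s (+-monoʳ-< h y<h) ; back-nbr = sym (+-assoc r h y)
    ; port-nbr = refl ; nbr≢ = <⇒≢ (subst (suc q <_) (sym (+-assoc r h y)) (hub<r+ (h + y)))
    ; level = ≤-trans (n≤1+n (suc q)) (n≤1+n r) }
  edge-right {y} {suc x} y<h (s≤s x<h) = link kind-right (kind-left x<h) record
    { nbr<size = left<size x<h ; back<deg = s≤s y<h ; back-nbr = refl ; port-nbr = refl
    ; nbr≢ = <⇒≢ (left<right y x<h) ; level = n≤1+n r }

  degree : ℕ → ℕ
  degree v = degK (kind v)

  level : ℕ → ℕ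
  level v = levelK (kind v)

  edge : ∀ {v i} → v < size → i < degree v → Edge v i
  edge {v} {i} v<size i<deg with shape v<size
  ... | path-vertex k k≤q = edge-path k≤q (subst (λ κ → i < degK κ) (kind-path k≤q) i<deg)
  ... | hub-vertex = edge-hub (subst (λ κ → i < degK κ) kind-hub i<deg)
  ... | left-vertex x x<h = edge-left x<h (subst (λ κ → i < degK κ) (kind-left x<h) i<deg)
  ... | right-vertex y y<h = edge-right y<h (subst (λ κ → i < degK κ) kind-right i<deg)

  table : PortTable
  table = record
    { size = size ; degree = degree ; nbr = nbrK ∘ kind ; port = λ v w → portK (kind v) (kind w)
    ; valid = λ v<size i<deg → let open Link (edge v<size i<deg) in
        record { nbr<size = nbr<size ; port<deg = back<deg ; nbr-port = back-nbr ; port-nbr = port-nbr ; nbr≢ = nbr≢ } }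

  open TableGraph table public

  origin : Fin size
  origin = Fin.zero

  level-step : ∀ {v i} → v < size → i < degree v → level (nbrK (kind v) i) ≤ suc (level v)
  level-step v<size i<deg = Link.level (edge v<size i<deg)

  graph-level-step : ∀ v i → level (toℕ (proj₁ (adj graph v i))) ≤ suc (level (toℕ v))
  graph-level-step = adjacent-level-step level level-step

  origin-level : level (toℕ origin) ≡ 0
  origin-level = cong levelK (kind-path z≤n)

  level≤r : ∀ {v} → v < size → level v ≤ r
  level≤r v<size with shape v<size
  ... | path-vertex k k≤q = subst (λ κ → levelK κ ≤ r) (sym (kind-path k≤q)) (≤-trans k≤q q≤r)
  ... | hub-vertex = subst (λ κ → levelK κ ≤ r) (sym kind-hub) (n≤1+n (suc q))
  ... | left-vertex x x<h = subst (λ κ → levelK κ ≤ r) (sym (kind-left x<h)) ≤-refl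
  ... | right-vertex y y<h = subst (λ κ → levelK κ ≤ r) (sym kind-right) ≤-refl

  level≡0 : ∀ {v} → v < size → level v ≡ 0 → v ≡ 0
  level≡0 v<size level≡ with shape v<size
  ... | path-vertex k k≤q = trans (cong levelK (sym (kind-path k≤q))) level≡
  ... | hub-vertex = ⊥-elim (1+n≢0 (trans (cong levelK (sym kind-hub)) level≡))
  ... | left-vertex x x<h = ⊥-elim (1+n≢0 (trans (cong levelK (sym (kind-left x<h))) level≡))
  ... | right-vertex y y<h = ⊥-elim (1+n≢0 (trans (cong levelK (sym kind-right)) level≡))

  reach-path : ∀ {k} → k ≤ suc q → Reach origin k k
  reach-path {zero} _ = origin , refl , here
  reach-path {suc k} (s≤s k≤q) =
    subst (Reach origin (suc k)) (cong (λ κ → nbrK κ 0) (kind-path k≤q))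
          (reach-step (reach-path (m≤n⇒m≤1+n k≤q)) (subst (λ κ → 0 < degK κ) (sym (kind-path k≤q)) (degK-pos k)))

  reach-biclique : ∀ {j} → j < h + h → Reach origin r (r + j)
  reach-biclique {j} j<h+h =
    subst (Reach origin r) (cong (λ κ → nbrK κ (suc j)) kind-hub)
          (reach-step (reach-path ≤-refl) (subst (λ κ → suc j < degK κ) (sym kind-hub) (s≤s j<h+h)))

  reach : ∀ {v} → v < size → Σ ℕ λ ℓ → ℓ ≤ r × Reach origin ℓ v
  reach v<size with shape v<size
  ... | path-vertex k k≤q = k , ≤-trans k≤q q≤r , reach-path (m≤n⇒m≤1+n k≤q)
  ... | hub-vertex = suc q , n≤1+n (suc q) , reach-path ≤-refl
  ... | left-vertex x x<h = r , ≤-refl , reach-biclique (≤-trans x<h (m≤m+n h h))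
  ... | right-vertex y y<h = r , ≤-refl , subst (Reach origin r) (sym (+-assoc r h y)) (reach-biclique (+-monoʳ-< h y<h))

  eccentricity : Eccentricity graph origin r
  eccentricity = nearby , far , far-distance
    where
    nearby : ∀ v → Σ ℕ λ ℓ → ℓ ≤ r × Walk graph origin v ℓ
    nearby v with reach (toℕ<n v)
    ... | ℓ , ℓ≤r , reached = ℓ , ℓ≤r , reach-vertex reached
    far : Fin size
    far = fromℕ< (left<size 0<h)
    far-distance : ∀ ℓ → Walk graph origin far ℓ → r ≤ ℓ
    far-distance ℓ w = subst₂ _≤_ level-far (cong (λ κ → levelK κ + ℓ) (kind-path z≤n))
                         (walk-level graph (level ∘ toℕ) graph-level-step w)
      where
      level-far : level (toℕ far) ≡ r
      level-far = trans (cong level (toℕ-fromℕ< (left<size 0<h))) (cong levelK (kind-left 0<h))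

  -- numEdges counts each edge at its smaller endpoint, and a right vertex has only smaller neighbours.
  upK : Kind → ℕ
  upK (right _) = 0
  upK k = degK k

  upK-cases : ∀ k → upK k ≡ degK k ⊎ Σ ℕ λ y → k ≡ right y
  upK-cases (path _) = inj₁ refl
  upK-cases hub = inj₁ refl
  upK-cases (left _) = inj₁ refl
  upK-cases (right y) = inj₂ (y , refl)

  upK≤ : ∀ k → upK k ≤ suc (h + h)
  upK≤ (path zero) = s≤s z≤n
  upK≤ (path (suc _)) = s≤s (≤-trans 0<h (m≤m+n h h))
  upK≤ hub = ≤-refl
  upK≤ (left _) = s≤s (m≤m+n h h)
  upK≤ (right _) = z≤n

  kind-right⇒ : ∀ {v y} → v < size → kind v ≡ right y → v ≡ r + h + y
  kind-right⇒ v<size kind≡ with shape v<size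
  ... | path-vertex k k≤q with () ← trans (sym (kind-path k≤q)) kind≡
  ... | hub-vertex with () ← trans (sym kind-hub) kind≡
  ... | left-vertex x x<h with () ← trans (sym (kind-left x<h)) kind≡
  ... | right-vertex y′ y′<h with refl ← trans (sym kind-right) kind≡ = refl

  right-nbr-below : ∀ {y i} → i < degK (right y) → nbrK (right y) i < r + h + y
  right-nbr-below {y} {zero} _ = subst (suc q <_) (sym (+-assoc r h y)) (hub<r+ (h + y))
  right-nbr-below {y} {suc x} (s≤s x<h) = left<right y x<h

  upward-ports-bound : ∀ v → upward-ports graph v ≤ upK (kind (toℕ v))
  upward-ports-bound v with upK-cases (kind (toℕ v))
  ... | inj₁ up≡deg = subst (upward-ports graph v ≤_) (sym up≡deg) (upward-ports≤deg graph v)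
  ... | inj₂ (y , kind≡right) = ≤-reflexive (trans (upward-ports-none graph v below) (cong upK (sym kind≡right)))
    where
    v≡ : toℕ v ≡ r + h + y
    v≡ = kind-right⇒ (toℕ<n v) kind≡right
    below : ∀ i → ¬ toℕ v < toℕ (proj₁ (adj graph v i))
    below i v<w = <-asym v<w
      (subst₂ _<_ nbr≡ (sym v≡) (right-nbr-below (subst (λ κ → toℕ i < degK κ) kind≡right (toℕ<n i))))
      where
      nbr≡ : nbrK (right y) (toℕ i) ≡ toℕ (proj₁ (adj graph v i))
      nbr≡ = sym (trans (adjacent-nbr v i) (cong (λ κ → nbrK κ (toℕ i)) kind≡right))

  numEdges-bound : numEdges graph ≤ r * suc (h + h) + h * suc h
  numEdges-bound = begin
    numEdges graph                          ≤⟨ numEdges-≤ graph up upward-ports-bound ⟩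
    sum (applyUpTo up (r + (h + h)))        ≡⟨ split ⟩
    on-path + (on-left + on-right)          ≤⟨ +-mono-≤ path-part (+-mono-≤ left-part right-part) ⟩
    r * suc (h + h) + (h * suc h + 0)       ≡⟨ cong (r * suc (h + h) +_) (+-identityʳ (h * suc h)) ⟩
    r * suc (h + h) + h * suc h             ∎
    where
    open ≤-Reasoning
    up : ℕ → ℕ
    up = upK ∘ kind
    on-path on-left on-right : ℕ
    on-path = sum (applyUpTo up r)
    on-left = sum (applyUpTo (up ∘ (r +_)) h)
    on-right = sum (applyUpTo (up ∘ (r +_) ∘ (h +_)) h)
    split : sum (applyUpTo up (r + (h + h))) ≡ on-path + (on-left + on-right)
    split = trans (sum-applyUpTo-+ up r (h + h)) (cong (on-path +_) (sum-applyUpTo-+ (up ∘ (r +_)) h h))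
    path-part : on-path ≤ r * suc (h + h)
    path-part = sum-applyUpTo-≤ up r (λ i _ → upK≤ (kind i))
    left-part : on-left ≤ h * suc h
    left-part = sum-applyUpTo-≤ _ h (λ x x<h → ≤-reflexive (cong upK (kind-left x<h)))
    right-part : on-right ≤ 0
    right-part = ≤-trans (sum-applyUpTo-≤ _ h (λ y _ → ≤-reflexive (cong upK (trans (cong kind (sym (+-assoc r h y)))
                                                                                       kind-right))))
                         (≤-reflexive (*-zeroʳ h))

  module Run (A : Algorithm) (F : ℕ) (solution : Execution.Solves graph origin A F) where
    open Execution graph origin A
    open Trace graph origin A

    T : ℕ
    T = proj₁ solution

    halts : Halts T
    halts = proj₁ (proj₂ solution)

    fuelOK : FuelOK F T
    fuelOK = proj₁ (proj₂ (proj₂ solution))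

    covers : Covers T
    covers = proj₂ (proj₂ (proj₂ solution))

    L : ℕ → ℕ
    L t = level (toℕ (position t))

    L-step : ∀ t → t < T → L (suc t) ≤ suc (L t) × L t ≤ suc (L (suc t))
    L-step t t<T with position-step halts t<T
    ... | i , next≡ = subst (λ w → level (toℕ w) ≤ suc (L t)) (sym next≡) (graph-level-step (position t) i)
                    , subst (λ w → L t ≤ suc (level (toℕ w))) (sym next≡)
                            (lvl-step-back graph (level ∘ toℕ) graph-level-step (position t) i)

    At-origin⇒L≡0 : ∀ t → At t origin → L t ≡ 0
    At-origin⇒L≡0 t at = trans (cong (level ∘ toℕ) (At⇒position t at)) origin-level

    L≡0⇒At-origin : ∀ {t} → t ≤ T → L t ≡ 0 → At t origin
    L≡0⇒At-origin {t} t≤T Lt≡0 =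
      subst (At t) (toℕ-injective (level≡0 (toℕ<n (position t)) Lt≡0)) (At-position halts t≤T)

    fuel : ∀ i j → i ≤ j → j ≤ T → L i ≡ 0 → (∀ m → i < m → m < j → L m ≢ 0) → j ∸ i ≤ F
    fuel i j i≤j j≤T Li≡0 away = fuelOK i j i≤j j≤T (L≡0⇒At-origin (≤-trans i≤j j≤T) Li≡0)
                                        (λ m i<m m<j at → away m i<m m<j (At-origin⇒L≡0 m at))

    open Excursions L r F T origin-level L-step fuel public

    left-vertex-at : Fin h → Fin size
    left-vertex-at x = fromℕ< (left<size (toℕ<n x))

    left-code : ∀ x → toℕ (left-vertex-at x) ≡ r + toℕ x
    left-code x = toℕ-fromℕ< (left<size (toℕ<n x))

    kind-left-vertex-at : ∀ x → kind (toℕ (left-vertex-at x)) ≡ left (toℕ x)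
    kind-left-vertex-at x = trans (cong kind (left-code x)) (kind-left (toℕ<n x))

    right-port< : ∀ x (y : Fin h) → suc (toℕ y) < degree (toℕ (left-vertex-at x))
    right-port< x y = subst (λ κ → suc (toℕ y) < degK κ) (sym (kind-left-vertex-at x)) (s≤s (toℕ<n y))

    port-to-right : ∀ x → Fin h → Fin (degree (toℕ (left-vertex-at x)))
    port-to-right x y = fromℕ< (right-port< x y)

    right-vertex-at : Fin h → Fin h → Fin size
    right-vertex-at x y = proj₁ (adj graph (left-vertex-at x) (port-to-right x y))

    right-code : ∀ x y → toℕ (right-vertex-at x y) ≡ r + h + toℕ y
    right-code x y = trans (adjacent-nbr (left-vertex-at x) (port-to-right x y))
      (trans (cong (nbrK (kind (toℕ (left-vertex-at x)))) (toℕ-fromℕ< (right-port< x y)))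
             (cong (λ κ → nbrK κ (suc (toℕ y))) (kind-left-vertex-at x)))

    crossing : ∀ xy → Σ ℕ λ m → m < T × Crosses m (left-vertex-at (proj₁ xy)) (uncurry right-vertex-at xy)
    crossing (x , y) = covered-crossing covers (left-vertex-at x) (port-to-right x y)

    crossing-time : Fin h × Fin h → ℕ
    crossing-time xy = proj₁ (crossing xy)

    crosses : ∀ xy → Crosses (crossing-time xy) (left-vertex-at (proj₁ xy)) (uncurry right-vertex-at xy)
    crosses xy = proj₂ (proj₂ (crossing xy))

    crossing-plateau : ∀ xy → L (crossing-time xy) ≡ r × L (suc (crossing-time xy)) ≡ r
    crossing-plateau (x , y) = crosses-level (level ∘ toℕ) (crossing-time (x , y)) (crosses (x , y))
      (cong levelK (kind-left-vertex-at x)) (trans (cong level (right-code x y)) (cong levelK kind-right))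

    crossing-injective : ∀ {xy xy′} → crossing-time xy ≡ crossing-time xy′ → xy ≡ xy′
    crossing-injective {x , y} {x′ , y′} same-time
      with crosses-same-edge (crossing-time (x , y)) (crosses (x , y))
             (subst (λ m → Crosses m (left-vertex-at x′) (right-vertex-at x′ y′)) (sym same-time) (crosses (x′ , y′)))
    ... | inj₁ (left≡ , right≡) = cong₂ _,_
            (toℕ-injective (+-cancelˡ-≡ r _ _ (trans (sym (left-code x)) (trans (cong toℕ left≡) (left-code x′)))))
            (toℕ-injective (+-cancelˡ-≡ (r + h) _ _
              (trans (sym (right-code x y)) (trans (cong toℕ right≡) (right-code x′ y′)))))
    ... | inj₂ (left≡right , _) = ⊥-elim (<⇒≢ (left<right (toℕ y′) (toℕ<n x))
            (trans (sym (left-code x)) (trans (cong toℕ left≡right) (right-code x′ y′))))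

    plateaus≥h² : h * h ≤ plateaus T
    plateaus≥h² = injective-marked⇒≤count plateau? (crossing-time ∘ pair) pair-crossing-injective
                    (proj₁ ∘ proj₂ ∘ crossing ∘ pair) (crossing-plateau ∘ pair)
      where
      pair : Fin (h * h) → Fin h × Fin h
      pair = remQuot {h} h
      pair-crossing-injective : ∀ {z z′} → crossing-time (pair z) ≡ crossing-time (pair z′) → z ≡ z′
      pair-crossing-injective {z} {z′} same-time = trans (sym (combine-remQuot {h} h z))
        (trans (cong (uncurry combine) (crossing-injective same-time)) (combine-remQuot {h} h z′))

    plateaus-bound-at-r : 2 * r * plateaus T ≤ K * slopes T + (2 * r + K) * r
    plateaus-bound-at-r =
      ≤-trans plateaus-bound (+-monoʳ-≤ (K * slopes T) (*-monoʳ-≤ (2 * r + K) (level≤r (toℕ<n (position T)))))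

    duration : T ≡ plateaus T + slopes T
    duration = sym (count-complement plateau? T)

-- The last summand on the left is the slack; writing r = q + 2 makes its coefficients nonnegative.
lollipop-identity : ∀ q K k →
  let r = 2 + q
      h = 2 * r + 3 * K + k
  in 2 * r * ((r + (h + h)) * (r + (h + h))) + 8 * (K * (r * suc (h + h) + h) + (2 * r + K) * r)
     + (2 * r * r * (7 * q + 6) + 8 * K * r * (5 * q + 6) + 24 * K * K * (q + 1)
        + 8 * K * k * (4 * q + 7) + 24 * k * r * r + 8 * k * k * r)
     ≡ 8 * (2 * r * (h * h))
lollipop-identity = solve-∀

penalty-arithmetic : ∀ q K k {D N E} →
  let r = 2 + q
      h = 2 * r + 3 * K + k
  in 2 * r * D ≤ K * N + (2 * r + K) * r → h * h ≤ D → E ≤ r * suc (h + h) + h * suc h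
     → 2 * r * ((r + (h + h)) * (r + (h + h))) ≤ 8 * (D + N ∸ E) * K
penalty-arithmetic q K k {D} {N} {E} plateau-bound h²≤D E≤ = +-cancelʳ-≤ X _ _ (begin
  2 * r * (size * size) + X           ≤⟨ m≤m+n _ _ ⟩
  2 * r * (size * size) + X + slack   ≡⟨ lollipop-identity q K k ⟩
  8 * (2 * r * (h * h))               ≤⟨ *-monoʳ-≤ 8 2rh²≤ ⟩
  8 * (K * (a + p) + c)               ≡⟨ spread K a p c ⟩
  8 * p * K + X                       ∎)
  where
  open ≤-Reasoning
  r h size a c p X slack : ℕ
  r = 2 + q
  h = 2 * r + 3 * K + k
  size = r + (h + h)
  a = r * suc (h + h) + h
  c = (2 * r + K) * r
  p = D + N ∸ E
  X = 8 * (K * a + c)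
  slack = 2 * r * r * (7 * q + 6) + 8 * K * r * (5 * q + 6) + 24 * K * K * (q + 1)
        + 8 * K * k * (4 * q + 7) + 24 * k * r * r + 8 * k * k * r
  spread : ∀ K a p c → 8 * (K * (a + p) + c) ≡ 8 * p * K + 8 * (K * a + c)
  spread = solve-∀
  E≤a+h² : E ≤ a + h * h
  E≤a+h² = ≤-trans E≤ (≤-reflexive
    (trans (cong (r * suc (h + h) +_) (*-suc h h)) (sym (+-assoc (r * suc (h + h)) h (h * h)))))
  N≤a+p : N ≤ a + p
  N≤a+p = +-cancelˡ-≤ D N (a + p) (begin
    D + N         ≤⟨ m≤n+m∸n (D + N) E ⟩
    E + p         ≤⟨ +-monoˡ-≤ p (≤-trans E≤a+h² (+-monoʳ-≤ a h²≤D)) ⟩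
    a + D + p     ≡⟨ cong (_+ p) (+-comm a D) ⟩
    D + a + p     ≡⟨ +-assoc D a p ⟩
    D + (a + p)   ∎)
  2rh²≤ : 2 * r * (h * h) ≤ K * (a + p) + c
  2rh²≤ = begin
    2 * r * (h * h)   ≤⟨ *-monoʳ-≤ (2 * r) h²≤D ⟩
    2 * r * D         ≤⟨ plateau-bound ⟩
    K * N + c         ≤⟨ +-monoˡ-≤ c (*-monoʳ-≤ K N≤a+p) ⟩
    K * (a + p) + c   ∎

theorem2 : (α : ℝ) (r : ℕ) → 2 ≤ r → Positive α → RAlphaAtLeast1 r α
    → (F : ℕ) → IsFloorFuel α r F
    → (A : Algorithm)
    → (∀ (G : PortGraph) (s : Fin (n G)) → Eccentricity G s r → Execution.Solves G s A F)
    → ∀ (k : ℕ) → 1 ≤ k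
    → Σ PortGraph λ G → Σ (Fin (n G)) λ s → Eccentricity G s r × k ≤ n G
      × Σ ℕ λ T → Execution.Halts G s A T
        × PenaltyAtLeast α (T ∸ numEdges G) (n G * n G)
theorem2 α r@(suc (suc q)) (s≤s (s≤s z≤n)) α>0 _ F (F<2r[1+α] , _) A solves k _ =
  graph , origin , eccentricity , k≤size , T , halts , penalty
  where
  K h : ℕ
  K = F ∸ 2 * r
  h = 2 * r + 3 * K + k
  open BicliqueLollipop q h z<s using (graph; origin; eccentricity; size; numEdges-bound; module Run)
  open Run A F (solves graph origin eccentricity) using (T; halts; duration; plateaus-bound-at-r; plateaus≥h²)
  k≤size : k ≤ size
  k≤size = ≤-trans (m≤n+m k (2 * r + 3 * K)) (≤-trans (m≤m+n h h) (m≤n+m (h + h) r))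
  cost : 2 * r * (size * size) ≤ 8 * (T ∸ numEdges graph) * K
  cost = subst (λ t → 2 * r * (size * size) ≤ 8 * (t ∸ numEdges graph) * K) (sym duration)
           (penalty-arithmetic q K k plateaus-bound-at-r plateaus≥h² numEdges-bound)
  penalty : PenaltyAtLeast α (T ∸ numEdges graph) (size * size)
  penalty u α<u = nx≤pk∧k<nu⇒x<pu {2 * r} {size * size} {8 * (T ∸ numEdges graph)} z<s z<s cost
    (m<n[1+u]⇒m∸n<nu {F} {2 * r} z<s (Lower<Upper α α>0 α<u) (F<2r[1+α] u α<u))
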